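{- Let $r\ge4$, let $A$ be an independent set in $G(n,r,1)$, with $A_0=\{v_1,\dots,v_k\}$, $I_0$ and $A_1$ as defined in the context, fix $x\in[n]\setminus I_0$, and let $B_i$ and $f$ be as defined in the context. If $i\neq j$ and $B_i\neq\emptyset$, $B_j\neq\emptyset$, then $f(u_1)\cap f(u_2)\neq\emptyset$ for all $u_1\in B_i$, $u_2\in B_j$.
   Context: $G(n,r,1)$ is the graph whose vertex set is the family of all $r$-element subsets of $[n]=\{1,\dots,n\}$, two vertices being adjacent iff they intersect in exactly one element. Given an independent set $A$, let $A_0=\{v_1,\dots,v_k\}\subseteq A$ be a subfamily of maximum size among subfamilies of $A$ consisting of pairwise disjoint sets, $I_0=v_1\cup\dots\cup v_k$, and $A_1$ the set of $v\in A\setminus A_0$ intersecting exactly one of $v_1,\dots,v_k$. For the fixed element $x$, $B_i=\{v\in A_1: x\in v,\ v\cap v_i\neq\emptyset\}$. For each $v\in B_i$ choose two distinct elements $y,z\in v\cap v_i$ (any choice) and set $f(v)=v\setminus\{x,y,z\}$, a set of size $r-3$. -}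

module Defs where

open import Data.Nat using (ℕ; _≤_)
open import Data.Fin using (Fin)
open import Data.Fin.Subset using (Subset; _∩_; _∈_; _-_; ∣_∣; Nonempty; Empty; ⋃)
open import Data.List using (List; tabulate)
open import Data.Product using (Σ; ∃; _×_)
open import Relation.Binary.PropositionalEquality using (_≡_; _≢_)
open import Relation.Nullary using (¬_)

-- Vertices of G(n,r,1): r-element subsets of [n] = Fin n.
-- Adjacency: intersecting in exactly one element.
Adjacent : ∀ {n} → Subset n → Subset n → Set
Adjacent u v = ∣ u ∩ v ∣ ≡ 1

IsIndependent : ∀ {n} (r : ℕ) → (Subset n → Set) → Set
IsIndependent {n} r A =
  (∀ u → A u → ∣ u ∣ ≡ r) ×
  (∀ u w → A u → A w → u ≢ w → ¬ Adjacent u w)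

Disjoint : ∀ {n} → Subset n → Subset n → Set
Disjoint u w = Empty (u ∩ w)

DisjointSubfamily : ∀ {n} → (Subset n → Set) → (m : ℕ) → (Fin m → Subset n) → Set
DisjointSubfamily A m w =
  (∀ i → A (w i)) × (∀ i j → i ≢ j → Disjoint (w i) (w j))

IsMaxDisjoint : ∀ {n} → (Subset n → Set) → (k : ℕ) → (Fin k → Subset n) → Set
IsMaxDisjoint {n} A k v =
  DisjointSubfamily A k v ×
  (∀ (m : ℕ) (w : Fin m → Subset n) → DisjointSubfamily A m w → m ≤ k)

I₀ : ∀ {n k} → (Fin k → Subset n) → Subset n
I₀ v = ⋃ (tabulate v)

InA₁ : ∀ {n k} → (Subset n → Set) → (Fin k → Subset n) → Subset n → Set
InA₁ {k = k} A v u =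
  A u × (∀ i → u ≢ v i) ×
  (∃ λ (i : Fin k) → Nonempty (u ∩ v i) × (∀ j → Nonempty (u ∩ v j) → j ≡ i))

InB : ∀ {n k} → (Subset n → Set) → (Fin k → Subset n) → Fin n → Fin k → Subset n → Set
InB A v x i u = InA₁ A v u × x ∈ u × Nonempty (u ∩ v i)

f : ∀ {n} → Fin n → Subset n → Fin n → Fin n → Subset n
f x u y z = u - x - y - z

module Submission where

-- Let u₁ ∈ B_i and u₂ ∈ B_j with i ≠ j.  A member of A₁ meets
-- exactly one block v_l of A₀, so u₁ meets only v_i, u₂ meets only v_j, and in
-- particular u₁ ≠ u₂.  Both lie in the independent set A and both contain x,
-- so u₁ ∩ u₂ is not a singleton and contains an element w ≠ x.  As w ∈ u₂ and
-- u₂ misses v_i, w ∉ v_i; symmetrically w ∉ v_j.  The removed points y₁, z₁ lie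
-- in v_i and y₂, z₂ lie in v_j, hence w survives in both f(u₁) and f(u₂).

open import Defs
open import Data.Nat using (ℕ; _≤_)
open import Data.Fin using (Fin)
open import Data.Fin.Properties using (any?; _≟_)
open import Data.Fin.Subset using (Subset; _∩_; _∈_; _∉_; Nonempty; ⁅_⁆; ∣_∣; _-_)
open import Data.Fin.Subset.Properties
  using (x∈p∩q⁺; x∈p∩q⁻; x∈p∧x∉q⇒x∈p─q; x∈⁅y⁆⇒x≡y; x∈⁅x⁆; ⊆-antisym; ∣⁅x⁆∣≡1; _∈?_)
open import Data.Product using (∃; _×_; _,_; proj₂)
open import Relation.Binary.PropositionalEquality using (_≢_; _≡_; refl; sym; trans; subst)
open import Relation.Nullary using (yes; no; contradiction)
open import Relation.Nullary.Decidable using (_×-dec_; ¬?)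

singleton-size : ∀ {n} {s : Subset n} {x : Fin n} →
  x ∈ s → (∀ y → y ∈ s → y ≡ x) → ∣ s ∣ ≡ 1
singleton-size {s = s} {x} x∈s only-x = subst (λ t → ∣ t ∣ ≡ 1) (sym s≡⁅x⁆) (∣⁅x⁆∣≡1 x)
  where
  s≡⁅x⁆ : s ≡ ⁅ x ⁆
  s≡⁅x⁆ = ⊆-antisym (λ {y} y∈s → subst (_∈ ⁅ x ⁆) (sym (only-x y y∈s)) (x∈⁅x⁆ x))
                    (λ {y} y∈⁅x⁆ → subst (_∈ s) (sym (x∈⁅y⁆⇒x≡y x y∈⁅x⁆)) x∈s)

second-element : ∀ {n} {s : Subset n} {x : Fin n} →
  x ∈ s → ∣ s ∣ ≢ 1 → ∃ λ w → w ∈ s × w ≢ x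
second-element {s = s} {x} x∈s ∣s∣≢1
  with any? (λ w → (w ∈? s) ×-dec ¬? (w ≟ x))
... | yes found = found
... | no none   = contradiction (singleton-size x∈s only-x) ∣s∣≢1
  where
  only-x : ∀ y → y ∈ s → y ≡ x
  only-x y y∈s with y ≟ x
  ... | yes y≡x = y≡x
  ... | no  y≢x = contradiction (y , y∈s , y≢x) none

survives-removal : ∀ {n} {u p : Subset n} {w x y z : Fin n} →
  w ∈ u → w ≢ x → w ∉ p → y ∈ p → z ∈ p → w ∈ f x u y z
survives-removal {p = p} {w} w∈u w≢x w∉p y∈p z∈p =
  remove (remove (remove w∈u w≢x) (avoid y∈p)) (avoid z∈p)
  where
  remove : ∀ {n} {q : Subset n} {a b : Fin n} → a ∈ q → a ≢ b → a ∈ q - b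
  remove {b = b} a∈q a≢b = x∈p∧x∉q⇒x∈p─q a∈q (λ a∈⁅b⁆ → a≢b (x∈⁅y⁆⇒x≡y b a∈⁅b⁆))
  avoid : ∀ {t} → t ∈ p → w ≢ t
  avoid t∈p refl = w∉p t∈p

A₁-meets-unique : ∀ {n k} {A : Subset n → Set} {v : Fin k → Subset n} {u : Subset n} →
  InA₁ A v u → ∀ {i j} → Nonempty (u ∩ v i) → Nonempty (u ∩ v j) → i ≡ j
A₁-meets-unique (_ , _ , _ , _ , unique) meets-i meets-j =
  trans (unique _ meets-i) (sym (unique _ meets-j))

A₁-misses-other : ∀ {n k} {A : Subset n → Set} {v : Fin k → Subset n} {u : Subset n} →
  InA₁ A v u → ∀ {i j} → Nonempty (u ∩ v i) → i ≢ j → ∀ {t} → t ∈ u → t ∉ v j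
A₁-misses-other {A = A} u∈A₁ meets-i i≢j t∈u t∈vj =
  i≢j (A₁-meets-unique {A = A} u∈A₁ meets-i (_ , x∈p∩q⁺ (t∈u , t∈vj)))

lemma6 : ∀ {n r : ℕ} → 4 ≤ r →
    (A : Subset n → Set) → IsIndependent r A →
    (k : ℕ) (v : Fin k → Subset n) → IsMaxDisjoint A k v →
    (x : Fin n) → x ∉ I₀ v →
    (i j : Fin k) → i ≢ j →
    ∃ (InB A v x i) → ∃ (InB A v x j) →
    (u₁ u₂ : Subset n) → InB A v x i u₁ → InB A v x j u₂ →
    (y₁ z₁ : Fin n) → y₁ ≢ z₁ → y₁ ∈ u₁ ∩ v i → z₁ ∈ u₁ ∩ v i →
    (y₂ z₂ : Fin n) → y₂ ≢ z₂ → y₂ ∈ u₂ ∩ v j → z₂ ∈ u₂ ∩ v j →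
    Nonempty (f x u₁ y₁ z₁ ∩ f x u₂ y₂ z₂)
lemma6 _ A (_ , independent) k v _ x _ i j i≢j _ _ u₁ u₂
  (u₁∈A₁@(Au₁ , _) , x∈u₁ , u₁-meets-i) (u₂∈A₁@(Au₂ , _) , x∈u₂ , u₂-meets-j)
  y₁ z₁ _ y₁∈ z₁∈ y₂ z₂ _ y₂∈ z₂∈ =
  survivor (second-element (x∈p∩q⁺ (x∈u₁ , x∈u₂)) (independent u₁ u₂ Au₁ Au₂ u₁≢u₂))
  where
  -- u₁ = u₂ would meet both v_i and v_j.
  u₁≢u₂ : u₁ ≢ u₂
  u₁≢u₂ refl = i≢j (A₁-meets-unique {A = A} u₁∈A₁ u₁-meets-i u₂-meets-j)

  in-block : ∀ {t u b} → t ∈ u ∩ b → t ∈ b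
  in-block {u = u} {b} t∈u∩b = proj₂ (x∈p∩q⁻ u b t∈u∩b)

  -- A second common element w ≠ x lies in neither v_i (as u₂ misses v_i)
  -- nor v_j (as u₁ misses v_j), so it survives in both f(u₁) and f(u₂).
  survivor : (∃ λ w → w ∈ u₁ ∩ u₂ × w ≢ x) → Nonempty (f x u₁ y₁ z₁ ∩ f x u₂ y₂ z₂)
  survivor (w , w∈u₁∩u₂ , w≢x) with x∈p∩q⁻ u₁ u₂ w∈u₁∩u₂
  ... | w∈u₁ , w∈u₂ = w , x∈p∩q⁺
    ( survives-removal w∈u₁ w≢x w∉vi (in-block y₁∈) (in-block z₁∈)
    , survives-removal w∈u₂ w≢x w∉vj (in-block y₂∈) (in-block z₂∈))
    where
    w∉vi : w ∉ v i
    w∉vi = A₁-misses-other {A = A} u₂∈A₁ u₂-meets-j (λ j≡i → i≢j (sym j≡i)) w∈u₂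
    w∉vj : w ∉ v j
    w∉vj = A₁-misses-other {A = A} u₁∈A₁ u₁-meets-i i≢j w∈u₁
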